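{- Let $m\ge 2$, and let $X$ and $f$ be the two-digit base-$m$ Kaprekar system. There exists $x\in X$ whose fixed set $K(x)$ is non-trivial and has cardinality $1$ if and only if $3\mid m+1$. Moreover, such a fixed set is unique: if $x,y\in X$ both have non-trivial fixed sets of cardinality $1$, then $K(x)=K(y)$.
   Context: $X=\{0,1,\dots,m^2-1\}$, each element written with exactly two base-$m$ digits $x=d_1m+d_0$ (leading zeros allowed). The map is $f(x)=\big(m\max(d_0,d_1)+\min(d_0,d_1)\big)-\big(m\min(d_0,d_1)+\max(d_0,d_1)\big)$. Iterates: $f^0=\mathrm{id}$ and $f^t=f\circ f^{t-1}$. For $x\in X$: $S(x)$ is the least $s\ge0$ such that $f^{s+t}(x)=f^s(x)$ for some $t\ge1$. $T(x)$ is the least $t\ge1$ with $f^{S(x)+t}(x)=f^{S(x)}(x)$. The fixed set is $K(x)=\{f^{S(x)+i}(x):0\le i<T(x)\}$. A fixed set is non-trivial if it is not $\{0\}$. -}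

module Defs where

open import Data.Nat using (ℕ; zero; suc; _+_; _*_; _∸_; _≤_; _<_; _⊔_; _⊓_; NonZero)
open import Data.Nat.DivMod using (_/_; _%_)
open import Data.Product using (Σ; ∃; _×_; _,_)
open import Relation.Binary.PropositionalEquality using (_≡_; _≢_)
open import Relation.Nullary using (¬_)
open import Function.Bundles using (_⇔_)

-- Two-digit base-m Kaprekar map on X = {0,…,m²-1}; x = d₁·m + d₀.
module _ (m : ℕ) .{{_ : NonZero m}} where

  d₀ : ℕ → ℕ
  d₀ x = x % m

  d₁ : ℕ → ℕ
  d₁ x = x / m

  -- (m·max + min) − (m·min + max); the true difference is ≥ 0, so ∸ is exact.
  kap : ℕ → ℕ
  kap x = (m * (d₀ x ⊔ d₁ x) + (d₀ x ⊓ d₁ x)) ∸ (m * (d₀ x ⊓ d₁ x) + (d₀ x ⊔ d₁ x))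

  iter : ℕ → ℕ → ℕ
  iter zero    x = x
  iter (suc t) x = kap (iter t x)

  Recurs : ℕ → ℕ → Set
  Recurs x s = ∃ λ t → 1 ≤ t × iter (s + t) x ≡ iter s x

  IsS : ℕ → ℕ → Set
  IsS x s = Recurs x s × (∀ s′ → s′ < s → ¬ Recurs x s′)

  IsT : ℕ → ℕ → ℕ → Set
  IsT x s t = 1 ≤ t × iter (s + t) x ≡ iter s x
              × (∀ t′ → 1 ≤ t′ → t′ < t → iter (s + t′) x ≢ iter s x)

  InK : ℕ → ℕ → Set
  InK x y = ∃ λ s → ∃ λ t → IsS x s × IsT x s t × ∃ λ i → i < t × y ≡ iter (s + i) x

  KSingleton : ℕ → Set
  KSingleton x = ∃ λ y → ∀ z → InK x z ⇔ z ≡ y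

  NonTrivial : ℕ → Set
  NonTrivial x = ¬ (∀ z → InK x z ⇔ z ≡ 0)

{-# OPTIONS --safe #-}

-- With m = n + 1, a number with digits a, b is sent by f to n·|a − b|, so a non-zero
-- fixed point of f in X is y = n·k with 0 < k < m.  Writing k = j + 1 and n = j + 1 + e,
-- the digits of n·k are j and e + 1, hence f(y) = n·|e + 1 − j|, and y is fixed exactly
-- when e = 2j, i.e. 3k = m + 1.  As K(x) is closed under f, a fixed set of cardinality
-- one is {y} for a fixed point y; so the non-trivial ones all equal {n·(m + 1)/3}.

module Submission where

open import Defs
open import Data.Nat using (ℕ; zero; suc; _+_; _*_; _∸_; _≤_; _<_; _⊔_; _⊓_; ∣_-_∣; NonZero; >-nonZero; s≤s; z<s)
open import Data.Nat.Properties
open import Data.Nat.DivMod using (_/_; _%_; [m+kn]%n≡m%n; m<n⇒m%n≡m; +-distrib-/-∣ʳ; m<n⇒m/n≡0; m*n/n≡m; m%n<n; m<n*o⇒m/o<n)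
open import Data.Nat.Divisibility using (_∣_; divides; divides-refl)
open import Data.Nat.Tactic.RingSolver using (solve)
open import Data.List using ([]; _∷_)
open import Data.Product using (∃; _×_; _,_)
open import Data.Sum using (inj₁; inj₂)
open import Data.Empty using (⊥-elim)
open import Relation.Binary.PropositionalEquality
open import Function.Bundles using (_⇔_; mk⇔; Equivalence)

open Equivalence

K[_]_≡｛_｝ : (m : ℕ) .{{_ : NonZero m}} → ℕ → ℕ → Set
K[ m ] x ≡｛ y ｝ = ∀ z → InK m x z ⇔ z ≡ y

module _ (m : ℕ) .{{_ : NonZero m}} where

  iter-fixed : ∀ {y} → kap m y ≡ y → ∀ t → iter m t y ≡ y
  iter-fixed fix zero    = refl
  iter-fixed fix (suc t) = trans (cong (kap m) (iter-fixed fix t)) fix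

  InK-kap-closed : ∀ {x y} → InK m x y → InK m x (kap m y)
  InK-kap-closed {x} (s , t , isS , isT@(1≤t , cycle , _) , i , i<t , refl) with m≤n⇒m<n∨m≡n i<t
  ... | inj₁ 1+i<t = s , t , isS , isT , suc i , 1+i<t , cong (λ u → iter m u x) (sym (+-suc s i))
  ... | inj₂ 1+i≡t = s , t , isS , isT , 0 , 1≤t , (begin
    kap m (iter m (s + i) x) ≡⟨ cong (λ u → iter m u x) (trans (sym (+-suc s i)) (cong (s +_) 1+i≡t)) ⟩
    iter m (s + t) x         ≡⟨ cycle ⟩
    iter m s x               ≡⟨ cong (λ u → iter m u x) (+-identityʳ s) ⟨
    iter m (s + 0) x         ∎)
    where open ≡-Reasoning

  K≡｛｝⇒fixed : ∀ {x y} → K[ m ] x ≡｛ y ｝ → kap m y ≡ y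
  K≡｛｝⇒fixed {y = y} K≡ = to (K≡ (kap m y)) (InK-kap-closed (from (K≡ y) refl))

  fixed⇒K≡｛｝ : ∀ {x} → kap m x ≡ x → K[ m ] x ≡｛ x ｝
  fixed⇒K≡｛｝ {x} fix z = mk⇔ (λ (s , t , _ , _ , i , _ , z≡) → trans z≡ (iter-fixed fix (s + i)))
                                (λ { refl → 0 , 1 , isS , isT , 0 , z<s , refl })
    where
    isS : IsS m x 0
    isS = (1 , z<s , fix) , λ _ ()
    isT : IsT m x 0 1
    isT = z<s , fix , λ { (suc _) _ (s≤s ()) }

  nonTrivial⇔ : ∀ {x y} → K[ m ] x ≡｛ y ｝ → NonTrivial m x ⇔ y ≢ 0
  nonTrivial⇔ {x} K≡ = mk⇔ (λ nt y≡0 → nt (λ z → subst (λ w → InK m x z ⇔ z ≡ w) y≡0 (K≡ z)))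
                           (λ y≢0 K≡0 → y≢0 (to (K≡0 _) (from (K≡ _) refl)))

  K≡｛｝-InK⇔ : ∀ {x x′ y} → K[ m ] x ≡｛ y ｝ → K[ m ] x′ ≡｛ y ｝ → ∀ z → InK m x z ⇔ InK m x′ z
  K≡｛｝-InK⇔ Kx≡ Kx′≡ z = mk⇔ (λ z∈Kx → from (Kx′≡ z) (to (Kx≡ z) z∈Kx))
                                (λ z∈Kx′ → from (Kx≡ z) (to (Kx′≡ z) z∈Kx′))

[r+q*m]%m≡r : ∀ {m} .{{_ : NonZero m}} r q → r < m → (r + q * m) % m ≡ r
[r+q*m]%m≡r {m} r q r<m = trans ([m+kn]%n≡m%n r q m) (m<n⇒m%n≡m r<m)

[r+q*m]/m≡q : ∀ {m} .{{_ : NonZero m}} r q → r < m → (r + q * m) / m ≡ q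
[r+q*m]/m≡q {m} r q r<m = begin
  (r + q * m) / m     ≡⟨ +-distrib-/-∣ʳ r (divides-refl q) ⟩
  r / m + q * m / m   ≡⟨ cong₂ _+_ (m<n⇒m/n≡0 r<m) (m*n/n≡m q m) ⟩
  q                   ∎
  where open ≡-Reasoning

reverse-digits-∸ : ∀ n a b → b ≤ a → (suc n * a + b) ∸ (suc n * b + a) ≡ n * (a ∸ b)
reverse-digits-∸ n a b b≤a with m≤n⇒∃[o]m+o≡n b≤a
... | k , refl = begin
  (suc n * (b + k) + b) ∸ (suc n * b + (b + k))                  ≡⟨ cong (_∸ (suc n * b + (b + k))) (solve (n ∷ b ∷ k ∷ [])) ⟩
  (suc n * b + (b + k)) + n * k ∸ (suc n * b + (b + k))          ≡⟨ m+n∸m≡n (suc n * b + (b + k)) (n * k) ⟩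
  n * k                                                          ≡⟨ cong (n *_) (m+n∸m≡n b k) ⟨
  n * (b + k ∸ b)                                                ∎
  where open ≡-Reasoning

reverse-digits-∣-∣ : ∀ n a b → (suc n * (a ⊔ b) + (a ⊓ b)) ∸ (suc n * (a ⊓ b) + (a ⊔ b)) ≡ n * ∣ a - b ∣
reverse-digits-∣-∣ n a b with ≤-total a b
... | inj₁ a≤b rewrite m≤n⇒m⊔n≡n a≤b | m≤n⇒m⊓n≡m a≤b | m≤n⇒∣m-n∣≡n∸m a≤b = reverse-digits-∸ n b a a≤b
... | inj₂ b≤a rewrite m≥n⇒m⊔n≡m b≤a | m≥n⇒m⊓n≡n b≤a | m≤n⇒∣n-m∣≡n∸m b≤a = reverse-digits-∸ n a b b≤a

∣1+e-j∣≡1+j⇔e≡j+j : ∀ e j → ∣ suc e - j ∣ ≡ suc j ⇔ e ≡ j + j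
∣1+e-j∣≡1+j⇔e≡j+j e j = mk⇔ ⇒ ⇐
  where
  ⇒ : ∣ suc e - j ∣ ≡ suc j → e ≡ j + j
  ⇒ gap≡ with ≤-total j (suc e)
  ... | inj₁ j≤1+e = suc-injective (trans (sym (m∸n+n≡m j≤1+e)) (cong (_+ j) (trans (sym (m≤n⇒∣n-m∣≡n∸m j≤1+e)) gap≡)))
  ... | inj₂ 1+e≤j = ⊥-elim (1+n≰n (subst (_≤ j) (trans (sym (m≤n⇒∣m-n∣≡n∸m 1+e≤j)) gap≡) (m∸n≤m j (suc e))))
  ⇐ : e ≡ j + j → ∣ suc e - j ∣ ≡ suc j
  ⇐ refl = begin
    ∣ suc (j + j) - j ∣   ≡⟨ ∣-∣-comm (suc (j + j)) j ⟩
    ∣ j - suc (j + j) ∣   ≡⟨ cong (∣ j -_∣) (+-suc j j) ⟨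
    ∣ j - j + suc j ∣     ≡⟨ ∣m-m+n∣≡n j (suc j) ⟩
    suc j                 ∎
    where open ≡-Reasoning

3[1+j]≡2+n⇔n≡j+1+2j : ∀ n j → 3 * suc j ≡ suc n + 1 ⇔ n ≡ j + suc (j + j)
3[1+j]≡2+n⇔n≡j+1+2j n j = mk⇔
  (λ eq → suc-injective (suc-injective (trans (+-comm 1 (suc n)) (trans (sym eq) 3[1+j]≡2+j+1+2j))))
  (λ { refl → trans 3[1+j]≡2+j+1+2j (+-comm 1 _) })
  where
  3[1+j]≡2+j+1+2j : 3 * suc j ≡ 2 + (j + suc (j + j))
  3[1+j]≡2+j+1+2j = solve (j ∷ [])

module _ (n : ℕ) where

  private
    m = suc n

  kap≡*digit-gap : ∀ y → kap m y ≡ n * ∣ d₀ m y - d₁ m y ∣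
  kap≡*digit-gap y = reverse-digits-∣-∣ n (d₀ m y) (d₁ m y)

  digit-gap< : ∀ {y} → y < m * m → ∣ d₀ m y - d₁ m y ∣ < m
  digit-gap< {y} y<m² = ≤-<-trans (∣m-n∣≤m⊔n (d₀ m y) (d₁ m y)) (⊔-lub (m%n<n y m) (m<n*o⇒m/o<n y<m²))

  kap-< : ∀ {y} → y < m * m → kap m y < m * m
  kap-< {y} y<m² = begin-strict
    kap m y                    ≡⟨ kap≡*digit-gap y ⟩
    n * ∣ d₀ m y - d₁ m y ∣    ≤⟨ *-monoʳ-≤ n (≤-pred (digit-gap< y<m²)) ⟩
    n * n                      <⟨ *-mono-< (n<1+n n) (n<1+n n) ⟩
    m * m                      ∎
    where open ≤-Reasoning

  iter-< : ∀ {x} → x < m * m → ∀ t → iter m t x < m * m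
  iter-< x<m² zero    = x<m²
  iter-< x<m² (suc t) = kap-< (iter-< x<m² t)

  InK-< : ∀ {x z} → x < m * m → InK m x z → z < m * m
  InK-< x<m² (s , _ , _ , _ , i , _ , refl) = iter-< x<m² (s + i)

kap-multiple : ∀ {n} j e → n ≡ j + suc e → kap (suc n) (n * suc j) ≡ n * ∣ suc e - j ∣
kap-multiple {n} j e refl = begin
  kap (suc n) (n * suc j)                                             ≡⟨ kap≡*digit-gap n (n * suc j) ⟩
  n * ∣ n * suc j % suc n - n * suc j / suc n ∣                       ≡⟨ cong (λ y → n * ∣ y % suc n - y / suc n ∣) n[1+j]≡1+e+jm ⟩
  n * ∣ (suc e + j * suc n) % suc n - (suc e + j * suc n) / suc n ∣   ≡⟨ cong₂ (λ r q → n * ∣ r - q ∣) ([r+q*m]%m≡r (suc e) j 1+e<1+n)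
                                                                                                          ([r+q*m]/m≡q (suc e) j 1+e<1+n) ⟩
  n * ∣ suc e - j ∣                                                   ∎
  where
  open ≡-Reasoning
  1+e<1+n : suc e < suc n
  1+e<1+n = s≤s (m≤n+m (suc e) j)
  n[1+j]≡1+e+jm : n * suc j ≡ suc e + j * suc n
  n[1+j]≡1+e+jm = solve (j ∷ e ∷ [])

fixed-multiple⇒3k≡2+n : ∀ n k → k ≢ 0 → k < suc n → kap (suc n) (n * k) ≡ n * k → 3 * k ≡ suc n + 1
fixed-multiple⇒3k≡2+n n zero    k≢0 _          _   = ⊥-elim (k≢0 refl)
fixed-multiple⇒3k≡2+n n (suc j) _   (s≤s j<n) fix with m≤n⇒∃[o]m+o≡n j<n
... | e , 1+j+e≡n = from (3[1+j]≡2+n⇔n≡j+1+2j n j) (trans n≡j+1+e (cong (λ e → j + suc e) (to (∣1+e-j∣≡1+j⇔e≡j+j e j) gap≡1+j)))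
  where
  n≡j+1+e : n ≡ j + suc e
  n≡j+1+e = trans (sym 1+j+e≡n) (sym (+-suc j e))
  gap≡1+j : ∣ suc e - j ∣ ≡ suc j
  gap≡1+j = *-cancelˡ-≡ _ _ n {{>-nonZero (<-≤-trans z<s j<n)}} (trans (sym (kap-multiple j e n≡j+1+e)) fix)

nonzero-fixed-point⇒ : ∀ n {y} → y < suc n * suc n → kap (suc n) y ≡ y → y ≢ 0 →
                       ∃ λ k → 3 * k ≡ suc n + 1 × y ≡ n * k
nonzero-fixed-point⇒ n {y} y<m² fix y≢0 =
  gap , fixed-multiple⇒3k≡2+n n gap gap≢0 (digit-gap< n y<m²) (subst (λ y → kap (suc n) y ≡ y) y≡n*gap fix) , y≡n*gap
  where
  gap : ℕ
  gap = ∣ d₀ (suc n) y - d₁ (suc n) y ∣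
  y≡n*gap : y ≡ n * gap
  y≡n*gap = trans (sym fix) (kap≡*digit-gap n y)
  gap≢0 : gap ≢ 0
  gap≢0 gap≡0 = y≢0 (trans y≡n*gap (trans (cong (n *_) gap≡0) (*-zeroʳ n)))

nonzero-fixed-point⇐ : ∀ n k → 3 * k ≡ suc n + 1 →
                       n * k < suc n * suc n × kap (suc n) (n * k) ≡ n * k × n * k ≢ 0
nonzero-fixed-point⇐ n (suc j) 3k≡2+n = *-mono-< (n<1+n n) (s≤s j<n) , fix , n*k≢0
  where
  n≡j+1+2j : n ≡ j + suc (j + j)
  n≡j+1+2j = to (3[1+j]≡2+n⇔n≡j+1+2j n j) 3k≡2+n
  j<n : j < n
  j<n = subst (j <_) (sym n≡j+1+2j) (m<m+n j z<s)
  fix : kap (suc n) (n * suc j) ≡ n * suc j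
  fix = trans (kap-multiple j (j + j) n≡j+1+2j) (cong (n *_) (from (∣1+e-j∣≡1+j⇔e≡j+j (j + j) j) refl))
  n*k≢0 : n * suc j ≢ 0
  n*k≢0 n*k≡0 = <⇒≢ (<-≤-trans z<s j<n) (sym (m*n≡0⇒m≡0 n (suc j) n*k≡0))

singleton-fixed-set : ∀ n {x} → x < suc n * suc n → NonTrivial (suc n) x → KSingleton (suc n) x →
                      ∃ λ k → 3 * k ≡ suc n + 1 × K[ suc n ] x ≡｛ n * k ｝
singleton-fixed-set n x<m² nt (y , K≡) with
  nonzero-fixed-point⇒ n (InK-< n x<m² (from (K≡ y) refl)) (K≡｛｝⇒fixed (suc n) K≡) (to (nonTrivial⇔ (suc n) K≡) nt)
... | k , 3k≡2+n , refl = k , 3k≡2+n , K≡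

lemma3p3p3 : (m : ℕ) .{{_ : NonZero m}} → 2 ≤ m →
    ((∃ λ x → x < m * m × NonTrivial m x × KSingleton m x) ⇔ (3 ∣ m + 1))
    × (∀ x y → x < m * m → y < m * m →
         NonTrivial m x → KSingleton m x → NonTrivial m y → KSingleton m y →
         ∀ z → InK m x z ⇔ InK m y z)
lemma3p3p3 (suc n) _ = mk⇔ existence⇒3∣ 3∣⇒existence , uniqueness
  where
  existence⇒3∣ : (∃ λ x → x < suc n * suc n × NonTrivial (suc n) x × KSingleton (suc n) x) → 3 ∣ suc n + 1
  existence⇒3∣ (x , x<m² , nt , singleton) with singleton-fixed-set n x<m² nt singleton
  ... | k , 3k≡2+n , _ = divides k (trans (sym 3k≡2+n) (*-comm 3 k))

  3∣⇒existence : 3 ∣ suc n + 1 → ∃ λ x → x < suc n * suc n × NonTrivial (suc n) x × KSingleton (suc n) x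
  3∣⇒existence (divides k 2+n≡k*3) with nonzero-fixed-point⇐ n k (trans (*-comm 3 k) (sym 2+n≡k*3))
  ... | x<m² , fix , x≢0 = n * k , x<m² , from (nonTrivial⇔ (suc n) K≡) x≢0 , (n * k , K≡)
    where
    K≡ : K[ suc n ] (n * k) ≡｛ n * k ｝
    K≡ = fixed⇒K≡｛｝ (suc n) fix

  uniqueness : ∀ x y → x < suc n * suc n → y < suc n * suc n →
               NonTrivial (suc n) x → KSingleton (suc n) x → NonTrivial (suc n) y → KSingleton (suc n) y →
               ∀ z → InK (suc n) x z ⇔ InK (suc n) y z
  uniqueness x y x<m² y<m² ntx sx nty sy
    with singleton-fixed-set n x<m² ntx sx | singleton-fixed-set n y<m² nty sy
  ... | k , 3k≡2+n , Kx≡ | k′ , 3k′≡2+n , Ky≡ rewrite *-cancelˡ-≡ k k′ 3 (trans 3k≡2+n (sym 3k′≡2+n)) =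
    K≡｛｝-InK⇔ (suc n) Kx≡ Ky≡
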